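{- Let $k\ge1$ and $t\ge3$ be integers and $n_1\ge n_2\ge\dots\ge n_t\ge1$ integers with $n_1,n_2\ge k^2-k+1$ and such that either $n_3\ge 2k-2$, or $n_3\ge k-1$ and $n_4\ge k-1$. Then $f(K_{n_1,n_2,\dots,n_t},k)=\sum_{i=3}^t n_i-2k+2$.
   Context: $K_{n_1,\dots,n_t}$ is the complete $t$-partite graph with parts of sizes $n_1,\dots,n_t$. For a graph $G$, $f(G,k)$ is the minimum, over all orientations of $G$, of the number of vertices having both indegree at least $k$ and outdegree at least $k$. -}

module Defs where

open import Data.Nat using (ℕ; zero; suc; _+_; _≤ᵇ_; _<ᵇ_)
open import Data.Fin using (Fin; zero; suc; toℕ)
open import Data.Bool using (Bool; true; false; not; if_then_else_; _∧_)
open import Data.Product using (Σ; _,_; proj₁)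
open import Relation.Binary.PropositionalEquality using (_≡_; _≢_)

∑ : (m : ℕ) → (Fin m → ℕ) → ℕ
∑ zero    f = 0
∑ (suc m) f = f zero + ∑ m (λ i → f (suc i))

-- 0-indexed access to the part sizes, with default 0 outside the range
at : ∀ {t} → (Fin t → ℕ) → ℕ → ℕ
at {zero}  n _       = 0
at {suc t} n zero    = n zero
at {suc t} n (suc i) = at (λ j → n (suc j)) i

Vtx : (t : ℕ) → (Fin t → ℕ) → Set
Vtx t n = Σ (Fin t) (λ i → Fin (n i))

Adj : ∀ {t} {n : Fin t → ℕ} → Vtx t n → Vtx t n → Set
Adj u v = proj₁ u ≢ proj₁ v

sumV : (t : ℕ) (n : Fin t → ℕ) → (Vtx t n → ℕ) → ℕ
sumV t n f = ∑ t (λ i → ∑ (n i) (λ b → f (i , b)))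

record Orientation (t : ℕ) (n : Fin t → ℕ) : Set where
  field
    arc      : Vtx t n → Vtx t n → Bool
    arc-edge : ∀ u v → arc u v ≡ true → Adj {t} {n} u v
    arc-one  : ∀ u v → Adj {t} {n} u v → arc u v ≡ not (arc v u)
open Orientation public

b2n : Bool → ℕ
b2n true  = 1
b2n false = 0

outdeg : ∀ {t n} → Orientation t n → Vtx t n → ℕ
outdeg {t} {n} o u = sumV t n (λ v → b2n (arc o u v))

indeg : ∀ {t n} → Orientation t n → Vtx t n → ℕ
indeg {t} {n} o u = sumV t n (λ v → b2n (arc o v u))

goodCount : ∀ {t n} → ℕ → Orientation t n → ℕ
goodCount {t} {n} k o =
  sumV t n (λ u → b2n ((k ≤ᵇ indeg o u) ∧ (k ≤ᵇ outdeg o u)))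

-- m = f(K_{n_1..n_t}, k): the minimum over all orientations of goodCount
record IsF (t : ℕ) (n : Fin t → ℕ) (k m : ℕ) : Set where
  field
    attained : Σ (Orientation t n) (λ o → goodCount k o ≡ m)
    lower    : ∀ (o : Orientation t n) → m Data.Nat.≤ goodCount k o

-- Σ_{i=3}^t n_i  (1-indexed), i.e. sum over 0-indexed i ≥ 2
tailSum : (t : ℕ) → (Fin t → ℕ) → ℕ
tailSum t n = ∑ t (λ i → if toℕ i <ᵇ 2 then 0 else n i)

-- Write K = k − 1 and call a vertex rich if its in- and out-degree both exceed K.
--
-- In any orientation, the vertices of in-degree at most K form a set X in which
-- every vertex has at most K in-neighbours, so X spans at most K|X| arcs. In a complete
-- multipartite graph this means: if X has m vertices in its largest part and r in the others,
-- then (m + r) r ≤ 2K(m + r) and 2mr ≤ 2K(m + r), whence r ≤ K or |X| ≤ (K + 1)². The same holds,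
-- after reversing the orientation, for the remaining vertices of out-degree at most K, and as
-- n₁ ≥ n₂ ≥ K² + K + 1 the two sets together have at most n₁ + n₂ + 2K vertices.
--
-- The hypothesis on n₃ (or on n₃ and n₄) leaves room for disjoint K-sets Z and W
-- inside V₃ (or V₃ and V₄). Orient every edge upwards along the layers
-- Z < V₁ < (the rest) < V₂ < W, breaking ties by the part index. Then every vertex of Z ∪ V₁
-- has all its in-neighbours in Z and every vertex of V₂ ∪ W has all its out-neighbours in W,
-- so only the n₃ + ⋯ + n_t − 2K vertices of the middle layer can be rich.

module Submission where

open import Data.Nat using (ℕ; _≤_; _*_; _∸_; _+_)
open import Data.Fin using (Fin)
import Data.Fin as F
import Data.Fin.Properties as F
open import Data.Product using (_×_)
open import Data.Sum using (_⊎_)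
open import Defs

open import Data.Nat using (zero; suc; _>_; z≤n; s≤s; s≤s⁻¹; _≤?_; _≤ᵇ_; _<ᵇ_; NonZero; >-nonZero)
open import Data.Nat.Properties
open import Data.Nat.Tactic.RingSolver using (solve)
open import Data.List using (_∷_; [])
open import Data.Fin using (zero; suc; toℕ; combine)
open import Data.Fin.Properties using (combine-injectiveʳ; combine-monoˡ-<)
open import Data.Fin.Patterns using (0F; 1F; 2F; 3F; 4F)
open import Data.Vec.Functional using (updateAt)
open import Data.Vec.Functional.Properties using (updateAt-updates; updateAt-minimal)
open import Data.Bool.Properties using (∧-zeroʳ)
open import Data.Bool using (Bool; true; false; not; _∧_; _∨_; if_then_else_; T)
open import Data.Product using (∃-syntax; Σ-syntax; _,_; proj₁)
open import Data.Sum using (inj₁; inj₂)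
import Data.Sum as Sum
open import Function using (_∘_; const; flip)
open import Relation.Nullary using (yes; no; does; contradiction)
open import Relation.Nullary.Decidable using (dec-true; dec-false)
open import Relation.Binary.PropositionalEquality
open import Algebra.Properties.Semiring.Sum +-*-semiring
  using (sum; sum-cong-≗; sum-replicate-zero; *-distribˡ-sum)
  renaming (∑-distrib-+ to sum-distrib-+; ∑-comm to sum-comm)
open import Algebra.Properties.CommutativeSemigroup +-commutativeSemigroup
  using () renaming (x∙yz≈y∙xz to x+[y+z]≡y+[x+z]; interchange to +-interchange)
open import Algebra.Properties.CommutativeSemigroup *-commutativeSemigroup
  using () renaming (x∙yz≈y∙xz to x*[y*z]≡y*[x*z])

b2n≤1 : ∀ x → b2n x ≤ 1
b2n≤1 true  = ≤-refl
b2n≤1 false = z≤n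

b2n-mono : ∀ {x y} → (x ≡ true → y ≡ true) → b2n x ≤ b2n y
b2n-mono {true}  x⇒y rewrite x⇒y refl = ≤-refl
b2n-mono {false} _   = z≤n

b2n-not : ∀ x → b2n (not x) + b2n x ≡ 1
b2n-not true  = refl
b2n-not false = refl

≤ᵇ≡false⇒> : ∀ {m n} → (m ≤ᵇ n) ≡ false → m > n
≤ᵇ≡false⇒> e = ≰⇒> (λ m≤n → subst T e (≤⇒≤ᵇ m≤n))

>⇒≤ᵇ≡false : ∀ {m n} → m > n → (m ≤ᵇ n) ≡ false
>⇒≤ᵇ≡false {m} {n} n<m with m ≤ᵇ n in e
... | false = refl
... | true  = contradiction (≤ᵇ⇒≤ m n (subst T (sym e) _)) (<⇒≱ n<m)

+-mono-≤-shifted : ∀ {a b N} a′ b′ K → a ≤ a′ + K → b ≤ b′ + K → a′ + b′ ≤ N → a + b ≤ N + (K + K)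
+-mono-≤-shifted {a} {b} {N} a′ b′ K a≤ b≤ sum≤ = begin
  a + b                  ≤⟨ +-mono-≤ a≤ b≤ ⟩
  (a′ + K) + (b′ + K)    ≡⟨ +-interchange a′ K b′ K ⟩
  (a′ + b′) + (K + K)    ≤⟨ +-monoˡ-≤ (K + K) sum≤ ⟩
  N + (K + K)            ∎
  where open ≤-Reasoning

∑≡sum : ∀ m (f : Fin m → ℕ) → ∑ m f ≡ sum f
∑≡sum zero    f = refl
∑≡sum (suc m) f = cong (f zero +_) (∑≡sum m (f ∘ suc))

∑-cong : ∀ m {f g : Fin m → ℕ} → f ≗ g → ∑ m f ≡ ∑ m g
∑-cong m {f} {g} f≗g rewrite ∑≡sum m f | ∑≡sum m g = sum-cong-≗ f≗g

∑-distrib-+ : ∀ m (f g : Fin m → ℕ) → ∑ m (λ i → f i + g i) ≡ ∑ m f + ∑ m g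
∑-distrib-+ m f g rewrite ∑≡sum m (λ i → f i + g i) | ∑≡sum m f | ∑≡sum m g =
  sum-distrib-+ f g

*-distribˡ-∑ : ∀ m c (f : Fin m → ℕ) → c * ∑ m f ≡ ∑ m (λ i → c * f i)
*-distribˡ-∑ m c f rewrite ∑≡sum m f | ∑≡sum m (λ i → c * f i) = *-distribˡ-sum c f

∑-comm : ∀ m p (f : Fin m → Fin p → ℕ) →
         ∑ m (λ i → ∑ p (f i)) ≡ ∑ p (λ j → ∑ m (λ i → f i j))
∑-comm m p f = begin
  ∑ m (λ i → ∑ p (f i))           ≡⟨ ∑∑≡sumsum m p f ⟩
  sum (λ i → sum (f i))           ≡⟨ sum-comm f ⟩
  sum (λ j → sum (flip f j))      ≡⟨ ∑∑≡sumsum p m (flip f) ⟨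
  ∑ p (λ j → ∑ m (λ i → f i j))   ∎
  where
  open ≡-Reasoning
  ∑∑≡sumsum : ∀ m p (f : Fin m → Fin p → ℕ) →
              ∑ m (λ i → ∑ p (f i)) ≡ sum (λ i → sum (f i))
  ∑∑≡sumsum m p f = trans (∑≡sum m _) (sum-cong-≗ (λ i → ∑≡sum p (f i)))

∑-mono-≤ : ∀ m {f g : Fin m → ℕ} → (∀ i → f i ≤ g i) → ∑ m f ≤ ∑ m g
∑-mono-≤ zero    f≤g = z≤n
∑-mono-≤ (suc m) f≤g = +-mono-≤ (f≤g zero) (∑-mono-≤ m (f≤g ∘ suc))

∑-ones : ∀ m → ∑ m (const 1) ≡ m
∑-ones zero    = refl
∑-ones (suc m) = cong suc (∑-ones m)

∑-bits≤ : ∀ m (f : Fin m → ℕ) → (∀ i → f i ≤ 1) → ∑ m f ≤ m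
∑-bits≤ m f f≤1 = ≤-trans (∑-mono-≤ m f≤1) (≤-reflexive (∑-ones m))

∑-zeros : ∀ m → ∑ m (const 0) ≡ 0
∑-zeros m = trans (∑≡sum m (const 0)) (sum-replicate-zero m)

∑-except : ∀ {m} → (Fin m → ℕ) → Fin m → ℕ
∑-except {m} f i = ∑ m (updateAt f i (const 0))

∑-split : ∀ m (f : Fin m → ℕ) i → ∑ m f ≡ f i + ∑-except f i
∑-split (suc m) f zero    = refl
∑-split (suc m) f (suc i) = begin
  f zero + ∑ m (f ∘ suc)                                            ≡⟨ cong (f zero +_) (∑-split m (f ∘ suc) i) ⟩
  f zero + (f (suc i) + ∑ m (updateAt (f ∘ suc) i (const 0)))       ≡⟨ x+[y+z]≡y+[x+z] (f zero) (f (suc i)) _ ⟩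
  f (suc i) + (f zero + ∑ m (updateAt (f ∘ suc) i (const 0)))       ∎
  where open ≡-Reasoning

term≤∑-except : ∀ m (f : Fin m → ℕ) {i j} → j ≢ i → f j ≤ ∑-except f i
term≤∑-except m f {i} {j} j≢i = begin
  f j                            ≡⟨ updateAt-minimal j i f j≢i ⟨
  updateAt f i (const 0) j       ≤⟨ m≤m+n _ _ ⟩
  updateAt f i (const 0) j + _   ≡⟨ ∑-split m (updateAt f i (const 0)) j ⟨
  ∑-except f i                   ∎
  where open ≤-Reasoning

∑-single : ∀ m (f : Fin m → ℕ) p → (∀ j → j ≢ p → f j ≡ 0) → ∑ m f ≡ f p
∑-single m f p vanish = begin
  ∑ m f                                ≡⟨ ∑-split m f p ⟩
  f p + ∑-except f p                   ≡⟨ cong (f p +_) (trans (∑-cong m rest≡0) (∑-zeros m)) ⟩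
  f p + 0                              ≡⟨ +-identityʳ (f p) ⟩
  f p                                  ∎
  where
  open ≡-Reasoning
  rest≡0 : ∀ j → updateAt f p (const 0) j ≡ 0
  rest≡0 j with j F.≟ p
  ... | yes refl = updateAt-updates j f
  ... | no j≢p   = trans (updateAt-minimal j p f j≢p) (vanish j j≢p)

-- The crossing inequality

-- (x − 1)(K² − x) ≥ 0, rearranged so that no subtraction occurs
K²+x²≤[K²+1]x : ∀ K x .{{_ : NonZero x}} → x ≤ K → K * K + x * x ≤ (K * K + 1) * x
K²+x²≤[K²+1]x K (suc z) x≤K = +-cancelʳ-≤ (z * (K * K)) _ _ (begin
  K * K + suc z * suc z + z * (K * K)  ≡⟨ solve (K ∷ z ∷ []) ⟩
  (K * K + 1) * suc z + z * suc z      ≤⟨ +-monoʳ-≤ _ (*-monoʳ-≤ z (≤-trans x≤K K≤K*K)) ⟩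
  (K * K + 1) * suc z + z * (K * K)    ∎)
  where
  open ≤-Reasoning
  K≤K*K : K ≤ K * K
  K≤K*K = m≤m*n K K {{>-nonZero (≤-trans (s≤s z≤n) x≤K)}}

large-crossing-bound : ∀ K m x .{{_ : NonZero x}} → x ≤ K → m * (K + x) ≤ K * (m + (K + x)) →
                       m + (K + x) ≤ suc K * suc K
large-crossing-bound K m x x≤K hyp = begin
  m + (K + x)        ≡⟨ solve (m ∷ K ∷ x ∷ []) ⟩
  (m + x) + K        ≤⟨ +-monoˡ-≤ K m+x≤ ⟩
  K * K + K + 1 + K  ≡⟨ solve (K ∷ []) ⟩
  suc K * suc K      ∎
  where
  open ≤-Reasoning
  mx≤ : m * x ≤ K * K + K * x
  mx≤ = +-cancelˡ-≤ (m * K) _ _ (begin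
    m * K + m * x              ≡⟨ *-distribˡ-+ m K x ⟨
    m * (K + x)                ≤⟨ hyp ⟩
    K * (m + (K + x))          ≡⟨ solve (K ∷ m ∷ x ∷ []) ⟩
    m * K + (K * K + K * x)    ∎)
  m+x≤ : m + x ≤ K * K + K + 1
  m+x≤ = *-cancelʳ-≤ (m + x) _ x (begin
    (m + x) * x                ≡⟨ *-distribʳ-+ x m x ⟩
    m * x + x * x              ≤⟨ +-monoˡ-≤ (x * x) mx≤ ⟩
    K * K + K * x + x * x      ≡⟨ solve (K ∷ x ∷ []) ⟩
    (K * K + x * x) + K * x    ≤⟨ +-monoˡ-≤ (K * x) (K²+x²≤[K²+1]x K x x≤K) ⟩
    (K * K + 1) * x + K * x    ≡⟨ solve (K ∷ x ∷ []) ⟩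
    (K * K + K + 1) * x        ∎)

-- m is the size of the largest class of a set and r the number of its remaining elements.
crossing-bound : ∀ K m r → (m + r) * r ≤ 2 * (K * (m + r)) → 2 * (m * r) ≤ 2 * (K * (m + r)) →
                 r ≤ K ⊎ m + r ≤ suc K * suc K
crossing-bound K m r sr≤ 2mr≤ with r ≤? K
... | yes r≤K = inj₁ r≤K
... | no r≰K with m≤n⇒∃[o]m+o≡n (≤-trans (n≤1+n K) (≰⇒> r≰K))
...   | zero  , refl = contradiction (≤-reflexive (+-identityʳ K)) r≰K
...   | suc z , refl = inj₂ (large-crossing-bound K m (suc z) x≤K (*-cancelˡ-≤ 2 2mr≤))
  where
  s : ℕ
  s = m + (K + suc z)
  r≤2K : K + suc z ≤ K + K
  r≤2K = *-cancelˡ-≤ s {{>-nonZero (≤-trans (s≤s z≤n) (m≤n⇒m≤o+n m (m≤n+m (suc z) K)))}} (begin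
    s * (K + suc z)   ≤⟨ sr≤ ⟩
    2 * (K * s)       ≡⟨ *-assoc 2 K s ⟨
    (2 * K) * s       ≡⟨ *-comm (2 * K) s ⟩
    s * (2 * K)       ≡⟨ cong (λ y → s * (K + y)) (+-identityʳ K) ⟩
    s * (K + K)       ∎)
    where open ≤-Reasoning
  x≤K : suc z ≤ K
  x≤K = +-cancelˡ-≤ K _ _ r≤2K

argmax : ∀ m (c : Fin (suc m) → ℕ) → ∃[ p ] (∀ i → c i ≤ c p)
argmax zero    c = zero , λ { zero → ≤-refl }
argmax (suc m) c with argmax m (c ∘ suc)
... | q , c≤cq with c zero ≤? c (suc q)
...   | yes c₀≤ = suc q , λ { zero → c₀≤ ; (suc i) → c≤cq i }
...   | no c₀≰  = zero  , λ { zero → ≤-refl ; (suc i) → ≤-trans (c≤cq i) (≰⇒≥ c₀≰) }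

-- Σ_i c_i (s − c_i): the number of ordered pairs of items in different classes.
crossSum : ∀ {m} → (Fin m → ℕ) → ℕ
crossSum {m} c = ∑ m (λ i → c i * ∑-except c i)

module _ {m : ℕ} (c : Fin m → ℕ) where

  ∑-except-max≤ : ∀ {p} → (∀ i → c i ≤ c p) → ∀ i → ∑-except c p ≤ ∑-except c i
  ∑-except-max≤ {p} c≤cp i = +-cancelˡ-≤ (c p) _ _ (begin
    c p + ∑-except c p     ≡⟨ ∑-split m c p ⟨
    ∑ m c                  ≡⟨ ∑-split m c i ⟩
    c i + ∑-except c i     ≤⟨ +-monoˡ-≤ _ (c≤cp i) ⟩
    c p + ∑-except c i     ∎)
    where open ≤-Reasoning

  ∑*∑-except-max≤crossSum : ∀ {p} → (∀ i → c i ≤ c p) → ∑ m c * ∑-except c p ≤ crossSum c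
  ∑*∑-except-max≤crossSum {p} c≤cp = begin
    ∑ m c * r                   ≡⟨ *-comm (∑ m c) r ⟩
    r * ∑ m c                   ≡⟨ *-distribˡ-∑ m r c ⟩
    ∑ m (λ i → r * c i)         ≤⟨ ∑-mono-≤ m (λ i → ≤-trans (≤-reflexive (*-comm r (c i)))
                                                             (*-monoʳ-≤ (c i) (∑-except-max≤ c≤cp i))) ⟩
    crossSum c                  ∎
    where
    open ≤-Reasoning
    r : ℕ
    r = ∑-except c p

  2*term*∑-except≤crossSum : ∀ p → 2 * (c p * ∑-except c p) ≤ crossSum c
  2*term*∑-except≤crossSum p = begin
    2 * (c p * r)                                  ≡⟨ cong (c p * r +_) (+-identityʳ _) ⟩
    c p * r + c p * r                              ≡⟨ cong (c p * r +_) (*-distribˡ-∑ m (c p) (updateAt c p (const 0))) ⟩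
    c p * r + ∑ m (λ i → c p * updateAt c p (const 0) i) ≤⟨ +-monoʳ-≤ (c p * r) (∑-mono-≤ m others) ⟩
    g p + ∑-except g p                             ≡⟨ ∑-split m g p ⟨
    crossSum c                                     ∎
    where
    open ≤-Reasoning
    r : ℕ
    r = ∑-except c p
    g : Fin m → ℕ
    g i = c i * ∑-except c i
    others : ∀ i → c p * updateAt c p (const 0) i ≤ updateAt g p (const 0) i
    others i with i F.≟ p
    ... | yes refl = ≤-trans (≤-reflexive (trans (cong (c p *_) (updateAt-updates p c)) (*-zeroʳ (c p)))) z≤n
    ... | no i≢p   = begin
      c p * updateAt c p (const 0) i   ≡⟨ cong (c p *_) (updateAt-minimal i p c i≢p) ⟩
      c p * c i                        ≤⟨ *-monoˡ-≤ (c i) (term≤∑-except m c (i≢p ∘ sym)) ⟩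
      ∑-except c i * c i               ≡⟨ *-comm _ (c i) ⟩
      g i                              ≡⟨ updateAt-minimal i p g i≢p ⟨
      updateAt g p (const 0) i         ∎

small-crossSum⇒concentrated : ∀ {m} K (c : Fin (suc m) → ℕ) →
  crossSum c ≤ 2 * (K * ∑ (suc m) c) →
  ∃[ p ] (∑ (suc m) c ≤ c p + K ⊎ ∑ (suc m) c ≤ suc K * suc K)
small-crossSum⇒concentrated {m} K c small with argmax m c
... | p , c≤cp = p , Sum.map (λ r≤K → ≤-trans (≤-reflexive s≡) (+-monoʳ-≤ (c p) r≤K)) (≤-trans (≤-reflexive s≡))
                             (crossing-bound K (c p) r sr≤ 2mr≤)
  where
  r : ℕ
  r = ∑-except c p
  s≡ : ∑ (suc m) c ≡ c p + r
  s≡ = ∑-split (suc m) c p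
  sr≤ : (c p + r) * r ≤ 2 * (K * (c p + r))
  sr≤ = subst (λ s → s * r ≤ 2 * (K * s)) s≡ (≤-trans (∑*∑-except-max≤crossSum c c≤cp) small)
  2mr≤ : 2 * (c p * r) ≤ 2 * (K * (c p + r))
  2mr≤ = subst (λ s → 2 * (c p * r) ≤ 2 * (K * s)) s≡ (≤-trans (2*term*∑-except≤crossSum c p) small)

module _ {t : ℕ} {n : Fin t → ℕ} where

  sumV-cong : {f g : Vtx t n → ℕ} → f ≗ g → sumV t n f ≡ sumV t n g
  sumV-cong f≗g = ∑-cong t (λ i → ∑-cong (n i) (λ b → f≗g (i , b)))

  sumV-mono-≤ : {f g : Vtx t n → ℕ} → (∀ u → f u ≤ g u) → sumV t n f ≤ sumV t n g
  sumV-mono-≤ f≤g = ∑-mono-≤ t (λ i → ∑-mono-≤ (n i) (λ b → f≤g (i , b)))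

  sumV-distrib-+ : (f g : Vtx t n → ℕ) → sumV t n (λ u → f u + g u) ≡ sumV t n f + sumV t n g
  sumV-distrib-+ f g = trans (∑-cong t (λ i → ∑-distrib-+ (n i) _ _)) (∑-distrib-+ t _ _)

  *-distribˡ-sumV : ∀ c (f : Vtx t n → ℕ) → c * sumV t n f ≡ sumV t n (λ u → c * f u)
  *-distribˡ-sumV c f = trans (*-distribˡ-∑ t c _) (∑-cong t (λ i → *-distribˡ-∑ (n i) c _))

  sumV-comm : (f : Vtx t n → Vtx t n → ℕ) →
              sumV t n (λ u → sumV t n (f u)) ≡ sumV t n (λ v → sumV t n (λ u → f u v))
  sumV-comm f = begin
    ∑ t (λ i → ∑ (n i) (λ b → ∑ t (λ j → ∑ (n j) (λ d → f (i , b) (j , d)))))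
      ≡⟨ ∑-cong t (λ i → ∑-comm (n i) t _) ⟩
    ∑ t (λ i → ∑ t (λ j → ∑ (n i) (λ b → ∑ (n j) (λ d → f (i , b) (j , d)))))
      ≡⟨ ∑-cong t (λ i → ∑-cong t (λ j → ∑-comm (n i) (n j) _)) ⟩
    ∑ t (λ i → ∑ t (λ j → ∑ (n j) (λ d → ∑ (n i) (λ b → f (i , b) (j , d)))))
      ≡⟨ ∑-comm t t _ ⟩
    ∑ t (λ j → ∑ t (λ i → ∑ (n j) (λ d → ∑ (n i) (λ b → f (i , b) (j , d)))))
      ≡⟨ ∑-cong t (λ j → ∑-comm t (n j) _) ⟩
    ∑ t (λ j → ∑ (n j) (λ d → ∑ t (λ i → ∑ (n i) (λ b → f (i , b) (j , d))))) ∎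
    where open ≡-Reasoning

  count : (Vtx t n → Bool) → ℕ
  count S = sumV t n (b2n ∘ S)

  countIn : (Vtx t n → Bool) → Fin t → ℕ
  countIn S i = ∑ (n i) (λ b → b2n (S (i , b)))

module _ {t : ℕ} {n : Fin t → ℕ} (o : Orientation t n) where

  arc-within-part : ∀ u v → proj₁ u ≡ proj₁ v → arc o u v ≡ false
  arc-within-part u v same with arc o u v in e
  ... | false = refl
  ... | true  = contradiction same (arc-edge o u v e)

  arc-across-parts : ∀ u v → Adj {t} {n} u v → b2n (arc o v u) + b2n (arc o u v) ≡ 1
  arc-across-parts u v adj = begin
    b2n (arc o v u) + b2n (arc o u v)          ≡⟨ cong (λ x → b2n x + b2n (arc o u v)) (arc-one o v u (adj ∘ sym)) ⟩
    b2n (not (arc o u v)) + b2n (arc o u v)    ≡⟨ b2n-not (arc o u v) ⟩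
    1                                          ∎
    where open ≡-Reasoning

  reverse : Orientation t n
  reverse = record
    { arc      = λ u v → arc o v u
    ; arc-edge = λ u v vu → arc-edge o v u vu ∘ sym
    ; arc-one  = λ u v adj → arc-one o v u (adj ∘ sym)
    }

  module _ (S : Vtx t n → Bool) where

    inFrom outTo : Vtx t n → ℕ
    inFrom u = sumV t n (λ v → b2n (S v) * b2n (arc o v u))
    outTo  u = sumV t n (λ v → b2n (S v) * b2n (arc o u v))

    inFrom≤indeg : ∀ u → inFrom u ≤ indeg o u
    inFrom≤indeg u = sumV-mono-≤ (λ v → ≤-trans (*-monoˡ-≤ _ (b2n≤1 (S v))) (≤-reflexive (*-identityˡ _)))

    sumV-outTo≡sumV-inFrom : sumV t n (λ u → b2n (S u) * outTo u) ≡ sumV t n (λ u → b2n (S u) * inFrom u)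
    sumV-outTo≡sumV-inFrom = begin
      sumV t n (λ u → χ u * outTo u)                              ≡⟨ sumV-cong (λ u → *-distribˡ-sumV (χ u) (λ v → χ v * a u v)) ⟩
      sumV t n (λ u → sumV t n (λ v → χ u * (χ v * a u v)))       ≡⟨ sumV-comm (λ u v → χ u * (χ v * a u v)) ⟩
      sumV t n (λ v → sumV t n (λ u → χ u * (χ v * a u v)))       ≡⟨ sumV-cong (λ v → sumV-cong (λ u → x*[y*z]≡y*[x*z] (χ u) (χ v) _)) ⟩
      sumV t n (λ v → sumV t n (λ u → χ v * (χ u * a u v)))       ≡⟨ sumV-cong (λ v → *-distribˡ-sumV (χ v) (λ u → χ u * a u v)) ⟨
      sumV t n (λ v → χ v * inFrom v)                             ∎
      where
      open ≡-Reasoning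
      χ : Vtx t n → ℕ
      χ = b2n ∘ S
      a : Vtx t n → Vtx t n → ℕ
      a u v = b2n (arc o u v)

    inFrom+outTo : ∀ u → inFrom u + outTo u ≡ ∑-except (countIn S) (proj₁ u)
    inFrom+outTo u@(i , _) = begin
      inFrom u + outTo u
        ≡⟨ sumV-distrib-+ (λ v → b2n (S v) * b2n (arc o v u)) (λ v → b2n (S v) * b2n (arc o u v)) ⟨
      sumV t n (λ v → b2n (S v) * b2n (arc o v u) + b2n (S v) * b2n (arc o u v))
        ≡⟨ sumV-cong (λ v → *-distribˡ-+ (b2n (S v)) _ _) ⟨
      sumV t n (λ v → b2n (S v) * (b2n (arc o v u) + b2n (arc o u v))) ≡⟨ ∑-cong t part ⟩
      ∑-except (countIn S) i                                             ∎
      where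
      open ≡-Reasoning
      part : ∀ j → ∑ (n j) (λ d → b2n (S (j , d)) * (b2n (arc o (j , d) u) + b2n (arc o u (j , d))))
                 ≡ updateAt (countIn S) i (const 0) j
      part j with j F.≟ i
      ... | yes refl = begin
        ∑ (n j) (λ d → b2n (S (j , d)) * (b2n (arc o (j , d) u) + b2n (arc o u (j , d))))
          ≡⟨ ∑-cong (n j) (λ d → cong (b2n (S (j , d)) *_)
               (cong₂ (λ x y → b2n x + b2n y) (arc-within-part (j , d) u refl) (arc-within-part u (j , d) refl))) ⟩
        ∑ (n j) (λ d → b2n (S (j , d)) * 0)  ≡⟨ ∑-cong (n j) (λ d → *-zeroʳ (b2n (S (j , d)))) ⟩
        ∑ (n j) (const 0)                    ≡⟨ ∑-zeros (n j) ⟩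
        0                                    ≡⟨ updateAt-updates j (countIn S) ⟨
        updateAt (countIn S) j (const 0) j   ∎
      ... | no j≢i = begin
        ∑ (n j) (λ d → b2n (S (j , d)) * (b2n (arc o (j , d) u) + b2n (arc o u (j , d))))
          ≡⟨ ∑-cong (n j) (λ d → trans (cong (b2n (S (j , d)) *_) (arc-across-parts u (j , d) (j≢i ∘ sym)))
                                        (*-identityʳ _)) ⟩
        countIn S j                          ≡⟨ updateAt-minimal j i (countIn S) j≢i ⟨
        updateAt (countIn S) i (const 0) j   ∎

    crossSum≡sumV : crossSum (countIn S) ≡ sumV t n (λ u → b2n (S u) * (inFrom u + outTo u))
    crossSum≡sumV = ∑-cong t (λ i → begin
      countIn S i * ∑-except (countIn S) i
        ≡⟨ *-comm (countIn S i) _ ⟩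
      ∑-except (countIn S) i * countIn S i
        ≡⟨ *-distribˡ-∑ (n i) (∑-except (countIn S) i) (λ b → b2n (S (i , b))) ⟩
      ∑ (n i) (λ b → ∑-except (countIn S) i * b2n (S (i , b)))
        ≡⟨ ∑-cong (n i) (λ b → trans (cong (b2n (S (i , b)) *_) (inFrom+outTo (i , b))) (*-comm (b2n (S (i , b))) _)) ⟨
      ∑ (n i) (λ b → b2n (S (i , b)) * (inFrom (i , b) + outTo (i , b))) ∎)
      where open ≡-Reasoning

    -- Each arc inside S is counted once at its head and once at its tail.
    crossSum≤2Kcount : ∀ K → (∀ u → S u ≡ true → indeg o u ≤ K) → crossSum (countIn S) ≤ 2 * (K * count S)
    crossSum≤2Kcount K poor = begin
      crossSum (countIn S)                                   ≡⟨ crossSum≡sumV ⟩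
      sumV t n (λ u → χ u * (inFrom u + outTo u))            ≡⟨ sumV-cong (λ u → *-distribˡ-+ (χ u) _ _) ⟩
      sumV t n (λ u → χ u * inFrom u + χ u * outTo u)        ≡⟨ sumV-distrib-+ (λ u → χ u * inFrom u) (λ u → χ u * outTo u) ⟩
      I + sumV t n (λ u → χ u * outTo u)                     ≡⟨ cong (I +_) sumV-outTo≡sumV-inFrom ⟩
      I + I                                                  ≡⟨ cong (I +_) (+-identityʳ I) ⟨
      2 * I                                                  ≤⟨ *-monoʳ-≤ 2 (sumV-mono-≤ bound) ⟩
      2 * sumV t n (λ u → K * χ u)                           ≡⟨ cong (2 *_) (*-distribˡ-sumV K χ) ⟨
      2 * (K * count S)                                      ∎
      where
      open ≤-Reasoning
      χ : Vtx t n → ℕ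
      χ = b2n ∘ S
      I : ℕ
      I = sumV t n (λ u → χ u * inFrom u)
      bound : ∀ u → χ u * inFrom u ≤ K * χ u
      bound u with S u in e
      ... | true  = begin
        1 * inFrom u   ≡⟨ *-identityˡ (inFrom u) ⟩
        inFrom u       ≤⟨ inFrom≤indeg u ⟩
        indeg o u      ≤⟨ poor u e ⟩
        K              ≡⟨ *-identityʳ K ⟨
        K * 1          ∎
      ... | false = z≤n

-- Lower bound

Concentrated : ∀ {t} {n : Fin t → ℕ} → ℕ → (Vtx t n → Bool) → Set
Concentrated K S = ∃[ p ] (count S ≤ countIn S p + K ⊎ count S ≤ suc K * suc K)

module _ {t : ℕ} {n : Fin t → ℕ} (K : ℕ) (o : Orientation t n) where

  inRich outRich : Vtx t n → Bool
  inRich  u = suc K ≤ᵇ indeg o u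
  outRich u = suc K ≤ᵇ outdeg o u

  inPoor outPoorOnly : Vtx t n → Bool
  inPoor      u = not (inRich u)
  outPoorOnly u = inRich u ∧ not (outRich u)

  inPoor⇒indeg≤ : ∀ u → inPoor u ≡ true → indeg o u ≤ K
  inPoor⇒indeg≤ u _ with inRich u in e
  ... | false = s≤s⁻¹ (≤ᵇ≡false⇒> e)

  outPoorOnly⇒outdeg≤ : ∀ u → outPoorOnly u ≡ true → indeg (reverse o) u ≤ K
  outPoorOnly⇒outdeg≤ u _ with inRich u | outRich u in e
  ... | true | false = s≤s⁻¹ (≤ᵇ≡false⇒> e)

  poor-disjoint : ∀ u → b2n (inPoor u) + b2n (outPoorOnly u) ≤ 1
  poor-disjoint u with inRich u
  ... | true  = b2n≤1 (not (outRich u))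
  ... | false = ≤-refl

  goodCount+poor≡∑ : goodCount (suc K) o + count inPoor + count outPoorOnly ≡ ∑ t n
  goodCount+poor≡∑ = begin
    goodCount (suc K) o + count inPoor + count outPoorOnly
      ≡⟨ cong (_+ count outPoorOnly) (sumV-distrib-+ (b2n ∘ rich) (b2n ∘ inPoor)) ⟨
    sumV t n (λ u → b2n (rich u) + b2n (inPoor u)) + count outPoorOnly
      ≡⟨ sumV-distrib-+ (λ u → b2n (rich u) + b2n (inPoor u)) (b2n ∘ outPoorOnly) ⟨
    sumV t n (λ u → b2n (rich u) + b2n (inPoor u) + b2n (outPoorOnly u))
      ≡⟨ sumV-cong one-class ⟩
    sumV t n (const 1)
      ≡⟨ ∑-cong t (λ i → ∑-ones (n i)) ⟩
    ∑ t n ∎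
    where
    open ≡-Reasoning
    rich : Vtx t n → Bool
    rich u = inRich u ∧ outRich u
    one-class : ∀ u → b2n (rich u) + b2n (inPoor u) + b2n (outPoorOnly u) ≡ 1
    one-class u with inRich u | outRich u
    ... | true  | true  = refl
    ... | true  | false = refl
    ... | false | _     = refl

module _ {t : ℕ} {n : Fin (suc t) → ℕ} (K : ℕ) (o : Orientation (suc t) n) where

  inPoor-concentrated : Concentrated K (inPoor K o)
  inPoor-concentrated =
    small-crossSum⇒concentrated K (countIn (inPoor K o)) (crossSum≤2Kcount o (inPoor K o) K (inPoor⇒indeg≤ K o))

  outPoorOnly-concentrated : Concentrated K (outPoorOnly K o)
  outPoorOnly-concentrated =
    small-crossSum⇒concentrated K (countIn (outPoorOnly K o))
      (crossSum≤2Kcount (reverse o) (outPoorOnly K o) K (outPoorOnly⇒outdeg≤ K o))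

module _ {t : ℕ} {n : Fin (suc (suc t)) → ℕ} where

  private
    n₀ n₁ : ℕ
    n₀ = n zero
    n₁ = n (suc zero)

  countIn≤ : ∀ S i → countIn S i ≤ n i
  countIn≤ S i = ∑-bits≤ (n i) _ (λ b → b2n≤1 (S (i , b)))

  disjoint-countIn≤ : ∀ X Y → (∀ u → b2n (X u) + b2n (Y u) ≤ 1) → ∀ i → countIn X i + countIn Y i ≤ n i
  disjoint-countIn≤ X Y disjoint i = begin
    countIn X i + countIn Y i                        ≡⟨ ∑-distrib-+ (n i) _ _ ⟨
    ∑ (n i) (λ b → b2n (X (i , b)) + b2n (Y (i , b))) ≤⟨ ∑-bits≤ (n i) _ (λ b → disjoint (i , b)) ⟩
    n i                                              ∎
    where open ≤-Reasoning

  module _ (n-decreasing : ∀ i j → i F.≤ j → n j ≤ n i) where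

    ≤-largest : ∀ i → n i ≤ n₀
    ≤-largest i = n-decreasing zero i z≤n

    two-largest : ∀ {p q} → p ≢ q → n p + n q ≤ n₀ + n₁
    two-largest {zero}  {zero}  p≢q = contradiction refl p≢q
    two-largest {zero}  {suc q} _   = +-monoʳ-≤ n₀ (n-decreasing (suc zero) (suc q) (s≤s z≤n))
    two-largest {suc p} {zero}  _   = ≤-trans (+-monoˡ-≤ n₀ (n-decreasing (suc zero) (suc p) (s≤s z≤n))) (≤-reflexive (+-comm n₁ n₀))
    two-largest {suc p} {suc q} _   = +-mono-≤ (≤-trans (n-decreasing (suc zero) (suc p) (s≤s z≤n)) (≤-largest (suc zero)))
                                               (n-decreasing (suc zero) (suc q) (s≤s z≤n))

    disjoint-countIn-pair≤ : ∀ X Y → (∀ u → b2n (X u) + b2n (Y u) ≤ 1) →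
                             ∀ p q → countIn X p + countIn Y q ≤ n₀ + n₁
    disjoint-countIn-pair≤ X Y disjoint p q with p F.≟ q
    ... | yes refl = ≤-trans (disjoint-countIn≤ X Y disjoint p) (≤-trans (≤-largest p) (m≤m+n n₀ n₁))
    ... | no p≢q   = ≤-trans (+-mono-≤ (countIn≤ X p) (countIn≤ Y q)) (two-largest p≢q)

    concentrated-pair≤ : ∀ K {X Y} → suc K * suc K ≤ n₁ + K → (∀ u → b2n (X u) + b2n (Y u) ≤ 1) →
                         Concentrated K X → Concentrated K Y → count X + count Y ≤ (n₀ + n₁) + (K + K)
    concentrated-pair≤ K {X} {Y} small≤ disjoint (p , inj₁ X≤) (q , inj₁ Y≤) =
      +-mono-≤-shifted (countIn X p) (countIn Y q) K X≤ Y≤ (disjoint-countIn-pair≤ X Y disjoint p q)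
    concentrated-pair≤ K {X} {Y} small≤ disjoint (p , inj₁ X≤) (_ , inj₂ Y≤) =
      +-mono-≤-shifted (countIn X p) n₁ K X≤ (≤-trans Y≤ small≤)
        (+-monoˡ-≤ n₁ (≤-trans (countIn≤ X p) (≤-largest p)))
    concentrated-pair≤ K {X} {Y} small≤ disjoint (_ , inj₂ X≤) (q , inj₁ Y≤) =
      +-mono-≤-shifted n₁ (countIn Y q) K (≤-trans X≤ small≤) Y≤
        (≤-trans (+-monoʳ-≤ n₁ (≤-trans (countIn≤ Y q) (≤-largest q))) (≤-reflexive (+-comm n₁ n₀)))
    concentrated-pair≤ K {X} {Y} small≤ disjoint (_ , inj₂ X≤) (_ , inj₂ Y≤) =
      +-mono-≤-shifted n₁ n₁ K (≤-trans X≤ small≤) (≤-trans Y≤ small≤) (+-monoˡ-≤ n₁ (≤-largest (suc zero)))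

    goodCount-lower : ∀ K → suc K * suc K ≤ n₁ + K → (o : Orientation (suc (suc t)) n) →
                      tailSum (suc (suc t)) n ∸ (K + K) ≤ goodCount (suc K) o
    goodCount-lower K small≤ o = m≤n+o⇒m∸n≤o _ (K + K) (+-cancelˡ-≤ (n₀ + n₁) _ _ (begin
      n₀ + n₁ + tailSum _ n              ≡⟨ +-assoc n₀ n₁ _ ⟩
      ∑ _ n                              ≡⟨ goodCount+poor≡∑ K o ⟨
      G + count X + count Y              ≡⟨ +-assoc G (count X) (count Y) ⟩
      G + (count X + count Y)            ≤⟨ +-monoʳ-≤ G X+Y≤ ⟩
      G + (n₀ + n₁ + (K + K))            ≡⟨ x+[y+z]≡y+[x+z] G (n₀ + n₁) (K + K) ⟩
      n₀ + n₁ + (G + (K + K))            ≡⟨ cong (n₀ + n₁ +_) (+-comm G (K + K)) ⟩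
      n₀ + n₁ + (K + K + G)              ∎))
      where
      open ≤-Reasoning
      G : ℕ
      G = goodCount (suc K) o
      X Y : Vtx (suc (suc t)) n → Bool
      X = inPoor K o
      Y = outPoorOnly K o
      X+Y≤ : count X + count Y ≤ n₀ + n₁ + (K + K)
      X+Y≤ = concentrated-pair≤ K small≤ (poor-disjoint K o) (inPoor-concentrated K o) (outPoorOnly-concentrated K o)

-- Upper bound

<ᵇ-flip : ∀ {m n} → m ≢ n → (m <ᵇ n) ≡ not (n <ᵇ m)
<ᵇ-flip {zero}  {zero}  m≢n = contradiction refl m≢n
<ᵇ-flip {zero}  {suc n} _   = refl
<ᵇ-flip {suc m} {zero}  _   = refl
<ᵇ-flip {suc m} {suc n} m≢n = <ᵇ-flip (m≢n ∘ cong suc)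

module _ {t : ℕ} {n : Fin t → ℕ} {m : ℕ} (key : Vtx t n → Fin m)
         (key-separates : ∀ u v → key u ≡ key v → proj₁ u ≡ proj₁ v) where

  byKey : Orientation t n
  byKey = record { arc = arc′ ; arc-edge = arc′-edge ; arc-one = arc′-one }
    where
    arc′ : Vtx t n → Vtx t n → Bool
    arc′ u v = not (does (proj₁ u F.≟ proj₁ v)) ∧ (toℕ (key u) <ᵇ toℕ (key v))
    arc′-edge : ∀ u v → arc′ u v ≡ true → Adj {t} {n} u v
    arc′-edge u v uv with proj₁ u F.≟ proj₁ v
    ... | no u≢v = u≢v
    arc′-one : ∀ u v → Adj {t} {n} u v → arc′ u v ≡ not (arc′ v u)
    arc′-one u v adj rewrite dec-false (proj₁ u F.≟ proj₁ v) adj | dec-false (proj₁ v F.≟ proj₁ u) (adj ∘ sym) =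
      <ᵇ-flip (adj ∘ key-separates u v ∘ F.toℕ-injective)

  arc-byKey : ∀ u v → arc byKey u v ≡ true → key u F.< key v
  arc-byKey u v uv with proj₁ u F.≟ proj₁ v
  ... | no _ = <ᵇ⇒< (toℕ (key u)) (toℕ (key v)) (subst T (sym uv) _)

module _ {t : ℕ} {n : Fin t → ℕ} where

  inTail : Vtx t n → Bool
  inTail (zero , _)          = false
  inTail (suc zero , _)      = false
  inTail (suc (suc _) , _)   = true

  count-inTail : count inTail ≡ tailSum t n
  count-inTail = ∑-cong t part
    where
    part : ∀ i → countIn inTail i ≡ (if toℕ i <ᵇ 2 then 0 else n i)
    part zero          = ∑-zeros (n zero)
    part (suc zero)    = ∑-zeros (n (suc zero))
    part (suc (suc i)) = ∑-ones (n (suc (suc i)))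

  module _ (Z W : Vtx t n → Bool) where

    middle : Vtx t n → Bool
    middle u = inTail u ∧ not (Z u ∨ W u)

    -- Layers Z < part 0 < middle < part 1 < W (parts numbered from 0); key breaks ties by part.
    rank : Vtx t n → Fin 5
    rank (zero , _)          = 1F
    rank (suc zero , _)      = 3F
    rank u@(suc (suc _) , _) = if Z u then 0F else if W u then 4F else 2F

    data RankSpec (u : Vtx t n) : Fin 5 → Set where
      in-Z      : Z u ≡ true        → RankSpec u 0F
      in-part₀  : toℕ (proj₁ u) ≡ 0 → RankSpec u 1F
      in-middle : middle u ≡ true   → RankSpec u 2F
      in-part₁  : toℕ (proj₁ u) ≡ 1 → RankSpec u 3F
      in-W      : W u ≡ true        → RankSpec u 4F

    rank-spec : ∀ u → RankSpec u (rank u)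
    rank-spec (zero , _)          = in-part₀ refl
    rank-spec (suc zero , _)      = in-part₁ refl
    rank-spec u@(suc (suc _) , _) with Z u in z | W u in w
    ... | true  | _     = in-Z z
    ... | false | true  = in-W w
    ... | false | false = in-middle (cong₂ (λ x y → not (x ∨ y)) z w)

    key : Vtx t n → Fin (5 * t)
    key u = combine (rank u) (proj₁ u)

    key-separates : ∀ u v → key u ≡ key v → proj₁ u ≡ proj₁ v
    key-separates u v = combine-injectiveʳ (rank u) (proj₁ u) (rank v) (proj₁ v)

    layered : Orientation t n
    layered = byKey key key-separates

    rank-monotone : ∀ u v → arc layered u v ≡ true → rank u F.≤ rank v
    rank-monotone u v uv = ≮⇒≥ (λ v<u →
      <-asym (arc-byKey key key-separates u v uv) (combine-monoˡ-< (proj₁ v) (proj₁ u) v<u))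

    rank1⇒part₀ : ∀ u → toℕ (rank u) ≡ 1 → toℕ (proj₁ u) ≡ 0
    rank1⇒part₀ u e with rank u | rank-spec u
    rank1⇒part₀ u () | 0F | _
    rank1⇒part₀ u _  | 1F | in-part₀ u₀ = u₀
    rank1⇒part₀ u () | 2F | _
    rank1⇒part₀ u () | 3F | _
    rank1⇒part₀ u () | 4F | _

    rank3⇒part₁ : ∀ u → toℕ (rank u) ≡ 3 → toℕ (proj₁ u) ≡ 1
    rank3⇒part₁ u e with rank u | rank-spec u
    rank3⇒part₁ u () | 0F | _
    rank3⇒part₁ u () | 1F | _
    rank3⇒part₁ u () | 2F | _
    rank3⇒part₁ u _  | 3F | in-part₁ u₁ = u₁
    rank3⇒part₁ u () | 4F | _

    Z-predecessor : ∀ u v → toℕ (rank u) ≤ 1 → arc layered v u ≡ true → Z v ≡ true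
    Z-predecessor u v u≤1 vu with rank v | rank-spec v | rank-monotone v u vu
    ... | 0F          | in-Z z      | _   = z
    ... | 1F          | in-part₀ v₀ | 1≤u = contradiction
      (F.toℕ-injective (trans v₀ (sym (rank1⇒part₀ u (≤-antisym u≤1 1≤u))))) (arc-edge layered v u vu)
    ... | suc (suc _) | _           | v≤u = contradiction (≤-trans v≤u u≤1) λ { (s≤s ()) }

    W-successor : ∀ u v → 3 ≤ toℕ (rank u) → arc layered u v ≡ true → W v ≡ true
    W-successor u v 3≤u uv with rank v | rank-spec v | rank-monotone u v uv
    ... | 4F    | in-W w      | _   = w
    ... | 3F    | in-part₁ v₁ | u≤3 = contradiction
      (F.toℕ-injective (trans (rank3⇒part₁ u (≤-antisym u≤3 3≤u)) (sym v₁))) (arc-edge layered u v uv)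
    ... | 0F    | _           | u≤v = contradiction (≤-trans 3≤u u≤v) λ ()
    ... | 1F    | _           | u≤v = contradiction (≤-trans 3≤u u≤v) λ { (s≤s ()) }
    ... | 2F    | _           | u≤v = contradiction (≤-trans 3≤u u≤v) λ { (s≤s (s≤s ())) }

    indeg≤count-Z : ∀ u → toℕ (rank u) ≤ 1 → indeg layered u ≤ count Z
    indeg≤count-Z u u≤1 = sumV-mono-≤ (λ v → b2n-mono (Z-predecessor u v u≤1))

    outdeg≤count-W : ∀ u → 3 ≤ toℕ (rank u) → outdeg layered u ≤ count W
    outdeg≤count-W u 3≤u = sumV-mono-≤ (λ v → b2n-mono (W-successor u v 3≤u))

    low-middle-or-high : ∀ u → toℕ (rank u) ≤ 1 ⊎ middle u ≡ true ⊎ 3 ≤ toℕ (rank u)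
    low-middle-or-high u with rank u | rank-spec u
    ... | 0F | _           = inj₁ z≤n
    ... | 1F | _           = inj₁ ≤-refl
    ... | 2F | in-middle m = inj₂ (inj₁ m)
    ... | 3F | _           = inj₂ (inj₂ ≤-refl)
    ... | 4F | _           = inj₂ (inj₂ (n≤1+n 3))

    module _ (K : ℕ) (|Z|≤K : count Z ≤ K) (|W|≤K : count W ≤ K) where

      rich⇒middle : ∀ u → b2n ((suc K ≤ᵇ indeg layered u) ∧ (suc K ≤ᵇ outdeg layered u)) ≤ b2n (middle u)
      rich⇒middle u with low-middle-or-high u
      ... | inj₁ low rewrite >⇒≤ᵇ≡false (s≤s (≤-trans (indeg≤count-Z u low) |Z|≤K)) = z≤n
      ... | inj₂ (inj₁ mid) rewrite mid = b2n≤1 _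
      ... | inj₂ (inj₂ high) rewrite >⇒≤ᵇ≡false (s≤s (≤-trans (outdeg≤count-W u high) |W|≤K))
                                   | ∧-zeroʳ (suc K ≤ᵇ indeg layered u) = z≤n

    module _ (Z⊆tail : ∀ u → Z u ≡ true → inTail u ≡ true) (W⊆tail : ∀ u → W u ≡ true → inTail u ≡ true)
             (Z∩W≡∅ : ∀ u → Z u ≡ true → W u ≡ false) where

      tail-split : ∀ u → b2n (Z u) + b2n (W u) + b2n (inTail u ∧ not (Z u ∨ W u)) ≡ b2n (inTail u)
      tail-split u with inTail u in tail | Z u in z | W u in w
      ... | true  | true  | true  = contradiction (trans (sym w) (Z∩W≡∅ u z)) λ ()
      ... | true  | true  | false = refl
      ... | true  | false | true  = refl
      ... | true  | false | false = refl
      ... | false | true  | _     = contradiction (trans (sym tail) (Z⊆tail u z)) λ ()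
      ... | false | false | true  = contradiction (trans (sym tail) (W⊆tail u w)) λ ()
      ... | false | false | false = refl

      count-middle : count Z + count W + count middle ≡ tailSum t n
      count-middle = begin
        count Z + count W + count middle
          ≡⟨ cong (_+ count middle) (sumV-distrib-+ (b2n ∘ Z) (b2n ∘ W)) ⟨
        sumV t n (λ u → b2n (Z u) + b2n (W u)) + count middle
          ≡⟨ sumV-distrib-+ (λ u → b2n (Z u) + b2n (W u)) (b2n ∘ middle) ⟨
        sumV t n (λ u → b2n (Z u) + b2n (W u) + b2n (middle u))
          ≡⟨ sumV-cong tail-split ⟩
        count inTail
          ≡⟨ count-inTail ⟩
        tailSum t n ∎
        where open ≡-Reasoning

      goodCount-layered : ∀ K → count Z ≡ K → count W ≡ K → goodCount (suc K) layered ≤ tailSum t n ∸ (K + K)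
      goodCount-layered K |Z|≡K |W|≡K = begin
        goodCount (suc K) layered           ≤⟨ sumV-mono-≤ (rich⇒middle K (≤-reflexive |Z|≡K) (≤-reflexive |W|≡K)) ⟩
        count middle                        ≡⟨ m+n∸m≡n (K + K) (count middle) ⟨
        K + K + count middle ∸ (K + K)      ≡⟨ cong (λ x → x + count middle ∸ (K + K)) (cong₂ _+_ |Z|≡K |W|≡K) ⟨
        count Z + count W + count middle ∸ (K + K) ≡⟨ cong (_∸ (K + K)) count-middle ⟩
        tailSum t n ∸ (K + K)               ∎
        where open ≤-Reasoning

inRange : ℕ → ℕ → ℕ → Bool
inRange lo hi x = not (x <ᵇ lo) ∧ (x <ᵇ hi)

count-inRange : ∀ m lo hi → hi ≤ m → ∑ m (λ b → b2n (inRange lo hi (toℕ b))) ≡ hi ∸ lo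
count-inRange zero    lo       zero     _ = sym (0∸n≡0 lo)
count-inRange (suc m) zero     zero     _ = ∑-zeros m
count-inRange (suc m) zero     (suc hi) h = cong suc (count-inRange m zero hi (s≤s⁻¹ h))
count-inRange (suc m) (suc lo) zero     _ =
  trans (∑-cong (suc m) (λ b → cong b2n (∧-zeroʳ (not (toℕ b <ᵇ suc lo))))) (∑-zeros (suc m))
count-inRange (suc m) (suc lo) (suc hi) h = count-inRange m lo hi (s≤s⁻¹ h)

inRange-disjoint : ∀ lo mid hi x → inRange lo mid x ≡ true → inRange mid hi x ≡ false
inRange-disjoint lo mid hi x e with x <ᵇ mid
... | true  = refl
... | false = contradiction (trans (sym e) (∧-zeroʳ (not (x <ᵇ lo)))) λ ()

module _ {t : ℕ} {n : Fin t → ℕ} where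

  block : Fin t → ℕ → ℕ → Vtx t n → Bool
  block p lo hi (i , b) = does (i F.≟ p) ∧ inRange lo hi (toℕ b)

  block⊆part : ∀ p lo hi u → block p lo hi u ≡ true → proj₁ u ≡ p
  block⊆part p lo hi (i , b) e with i F.≟ p
  ... | yes i≡p = i≡p

  count-block : ∀ p lo hi → hi ≤ n p → count (block p lo hi) ≡ hi ∸ lo
  count-block p lo hi hi≤ = begin
    count (block p lo hi)                                      ≡⟨ ∑-single t _ p outside ⟩
    ∑ (n p) (λ b → b2n (does (p F.≟ p) ∧ inRange lo hi (toℕ b))) ≡⟨ ∑-cong (n p) (λ b → cong (λ x → b2n (x ∧ _)) (dec-true (p F.≟ p) refl)) ⟩
    ∑ (n p) (λ b → b2n (inRange lo hi (toℕ b)))               ≡⟨ count-inRange (n p) lo hi hi≤ ⟩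
    hi ∸ lo                                                    ∎
    where
    open ≡-Reasoning
    outside : ∀ j → j ≢ p → countIn (block p lo hi) j ≡ 0
    outside j j≢p = trans (∑-cong (n j) (λ b → cong (λ x → b2n (x ∧ _)) (dec-false (j F.≟ p) j≢p))) (∑-zeros (n j))

  adjacent-blocks-disjoint : ∀ p lo mid hi u → block p lo mid u ≡ true → block p mid hi u ≡ false
  adjacent-blocks-disjoint p lo mid hi (i , b) e with i F.≟ p
  ... | yes _ = inRange-disjoint lo mid hi (toℕ b) e
  ... | no  _ = refl

  distant-blocks-disjoint : ∀ {p q} lo hi lo′ hi′ → p ≢ q → ∀ u → block p lo hi u ≡ true → block q lo′ hi′ u ≡ false
  distant-blocks-disjoint {p} {q} lo hi lo′ hi′ p≢q u@(i , b) e with refl ← block⊆part p lo hi u e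
    rewrite dec-false (i F.≟ q) p≢q = refl

module _ {t : ℕ} {n : Fin (suc (suc t)) → ℕ} where

  block⊆tail : ∀ {j} lo hi u → block {n = n} (suc (suc j)) lo hi u ≡ true → inTail u ≡ true
  block⊆tail lo hi u@(_ , _) e with refl ← block⊆part _ lo hi u e = refl

  blocks-orientation : ∀ K {j j′} lo hi lo′ hi′ →
    (∀ u → block (suc (suc j)) lo hi u ≡ true → block (suc (suc j′)) lo′ hi′ u ≡ false) →
    hi ≤ n (suc (suc j)) → hi′ ≤ n (suc (suc j′)) → hi ∸ lo ≡ K → hi′ ∸ lo′ ≡ K →
    Σ[ o ∈ Orientation (suc (suc t)) n ] goodCount (suc K) o ≤ tailSum (suc (suc t)) n ∸ (K + K)
  blocks-orientation K {j} {j′} lo hi lo′ hi′ disjoint hi≤ hi′≤ |Z|≡K |W|≡K =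
    layered Z W ,
    goodCount-layered Z W (block⊆tail lo hi) (block⊆tail lo′ hi′) disjoint K
      (trans (count-block {n = n} _ lo hi hi≤) |Z|≡K) (trans (count-block {n = n} _ lo′ hi′ hi′≤) |W|≡K)
    where
    Z W : Vtx (suc (suc t)) n → Bool
    Z = block (suc (suc j)) lo hi
    W = block (suc (suc j′)) lo′ hi′

tail-orientation : ∀ K t (n : Fin (3 + t) → ℕ) →
                   (K + K ≤ at n 2) ⊎ (K ≤ at n 2 × (4 ≤ 3 + t × K ≤ at n 3)) →
                   Σ[ o ∈ Orientation (3 + t) n ] goodCount (suc K) o ≤ tailSum (3 + t) n ∸ (K + K)
tail-orientation K t n (inj₁ 2K≤n₂) =
  blocks-orientation K 0 K K (K + K) (adjacent-blocks-disjoint 2F 0 K (K + K))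
    (≤-trans (m≤m+n K K) 2K≤n₂) 2K≤n₂ refl (m+n∸m≡n K K)
tail-orientation K (suc t) n (inj₂ (K≤n₂ , _ , K≤n₃)) =
  blocks-orientation K 0 K 0 K (distant-blocks-disjoint 0 K 0 K λ ()) K≤n₂ K≤n₃ refl refl
tail-orientation K zero n (inj₂ (_ , s≤s (s≤s (s≤s ())) , _))

IsF-from-bounds : ∀ {t n k m} → Σ[ o ∈ Orientation t n ] goodCount k o ≤ m →
                  (∀ o → m ≤ goodCount k o) → IsF t n k m
IsF-from-bounds (o , upper) lower = record { attained = o , ≤-antisym upper (lower o) ; lower = lower }

2[1+K]∸2≡K+K : ∀ K → 2 * suc K ∸ 2 ≡ K + K
2[1+K]∸2≡K+K K = trans (cong (_∸ 2) 2[1+K]≡2+[K+K]) (m+n∸m≡n 2 (K + K))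
  where
  2[1+K]≡2+[K+K] : 2 * suc K ≡ 2 + (K + K)
  2[1+K]≡2+[K+K] = solve (K ∷ [])

[1+K]²∸[1+K]+1+K≡[1+K]² : ∀ K → (suc K * suc K ∸ suc K + 1) + K ≡ suc K * suc K
[1+K]²∸[1+K]+1+K≡[1+K]² K = trans (cong (λ x → x + 1 + K) (m+n∸m≡n (suc K) (K * suc K))) (solve (K ∷ []))

theorem7 : (k t : ℕ) (n : Fin t → ℕ) →
    1 ≤ k → 3 ≤ t →
    (∀ i j → i F.≤ j → n j ≤ n i) →
    (∀ i → 1 ≤ n i) →
    k * k ∸ k + 1 ≤ at n 0 →
    k * k ∸ k + 1 ≤ at n 1 →
    (2 * k ∸ 2 ≤ at n 2) ⊎ (k ∸ 1 ≤ at n 2 × (4 ≤ t × k ∸ 1 ≤ at n 3)) →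
    IsF t n k (tailSum t n ∸ (2 * k ∸ 2))
theorem7 (suc K) (suc (suc (suc t))) n (s≤s _) (s≤s (s≤s (s≤s _))) n-decreasing _ _ n₁-large tail-large
  rewrite 2[1+K]∸2≡K+K K =
  IsF-from-bounds (tail-orientation K t n tail-large) (goodCount-lower n-decreasing K [1+K]²≤n₁+K)
  where
  [1+K]²≤n₁+K : suc K * suc K ≤ n 1F + K
  [1+K]²≤n₁+K = subst (_≤ n 1F + K) ([1+K]²∸[1+K]+1+K≡[1+K]² K) (+-monoˡ-≤ K n₁-large)
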